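{- For any pattern string $P$, the length of $sparse(P)$ is at least $\delta$, where $\delta$ is the number of distinct characters in $P$.
   Context: For an ordered pair of characters $u,v$ (not necessarily distinct), $sparse^{(u,v)}(P)$ is the rightmost occurrence in $P$ of a substring of $P$ of longest length that starts with $u$, ends with $v$, and contains no occurrence of $u$ or $v$ strictly inside it. $sparse(P)$ is the longest among the patterns $sparse^{(u,v)}(P)$ over all ordered pairs of characters $u,v$. -}

module Defs where

open import Data.Nat using (ℕ; zero; suc; _≤_; _<_; _∸_; _⊔_; _≤?_; _<?_)
open import Data.Fin using (Fin; toℕ)
open import Data.Fin.Properties using (all?)
open import Data.List using (List; length; lookup; allFin; filter; map; foldr; concatMap; deduplicate)
open import Data.Product using (_×_; _,_; proj₁; proj₂)
open import Relation.Binary.PropositionalEquality using (_≡_; _≢_)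
open import Relation.Binary.Definitions using (DecidableEquality)
open import Relation.Nullary using (Dec; ¬?)
open import Relation.Nullary.Decidable using (_×-dec_; _→-dec_)

SparseOcc : {A : Set} (P : List A) (u v : A) (i j : Fin (length P)) → Set
SparseOcc P u v i j =
  toℕ i ≤ toℕ j × lookup P i ≡ u × lookup P j ≡ v ×
  ((k : Fin (length P)) → toℕ i < toℕ k → toℕ k < toℕ j →
     lookup P k ≢ u × lookup P k ≢ v)

sparseOcc? : {A : Set} (_≟_ : DecidableEquality A) (P : List A) (u v : A)
             (i j : Fin (length P)) → Dec (SparseOcc P u v i j)
sparseOcc? _≟_ P u v i j =
  (toℕ i ≤? toℕ j) ×-dec ((lookup P i ≟ u) ×-dec ((lookup P j ≟ v) ×-dec
    all? (λ k → (toℕ i <? toℕ k) →-dec ((toℕ k <? toℕ j) →-dec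
      (¬? (lookup P k ≟ u) ×-dec ¬? (lookup P k ≟ v))))))

spanLen : {n : ℕ} → Fin n → Fin n → ℕ
spanLen i j = suc (toℕ j) ∸ toℕ i

maximum : List ℕ → ℕ
maximum = foldr _⊔_ 0

positionPairs : {A : Set} (P : List A) → List (Fin (length P) × Fin (length P))
positionPairs P = concatMap (λ i → map (λ j → (i , j)) (allFin (length P))) (allFin (length P))

-- |sparse^{(u,v)}(P)| : length of a longest (u,v)-sparse substring of P
-- (0 if there is none). Which occurrence is chosen (rightmost) does not
-- affect the length.
sparseUVLength : {A : Set} (_≟_ : DecidableEquality A) (P : List A) (u v : A) → ℕ
sparseUVLength _≟_ P u v =
  maximum (map (λ ij → spanLen (proj₁ ij) (proj₂ ij))
               (filter (λ ij → sparseOcc? _≟_ P u v (proj₁ ij) (proj₂ ij)) (positionPairs P)))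

alphabetOf : {A : Set} (_≟_ : DecidableEquality A) (P : List A) → List A
alphabetOf _≟_ P = deduplicate _≟_ P

numDistinct : {A : Set} (_≟_ : DecidableEquality A) (P : List A) → ℕ
numDistinct _≟_ P = length (alphabetOf _≟_ P)

-- |sparse(P)| : maximum of |sparse^{(u,v)}(P)| over all ordered pairs (u,v)
-- of characters (pairs with u or v not in P contribute nothing, so it
-- suffices to range over characters of P).
sparseLength : {A : Set} (_≟_ : DecidableEquality A) (P : List A) → ℕ
sparseLength _≟_ P =
  maximum (concatMap (λ u → map (λ v → sparseUVLength _≟_ P u v) (alphabetOf _≟_ P))
                     (alphabetOf _≟_ P))

-- Start from the window P[0..|P|-1], which contains every character of P, and shrink it
-- while it keeps containing every character: drop the first position if its character
-- occurs again later in the window, or the last position if its character occurs earlier.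
-- When neither move is possible, the window starts with u = P[i], ends with v = P[j] and
-- has no u or v strictly inside, so it is a (u,v)-sparse substring; having kept all δ
-- characters, it has length at least δ.
module Submission where

open import Defs
open import Data.Nat using (ℕ; zero; suc; _≤_; _<_; _+_; _∸_; pred; z≤n; s≤s; _≤?_; _<?_)
open import Data.Nat.Properties
open import Data.List using (List; []; _∷_; length; lookup; map; concatMap; deduplicate)
open import Data.List.Membership.Propositional using (_∈_)
open import Data.List.Membership.Propositional.Properties
  using (∈-lookup; ∈-map⁺; ∈-concatMap⁺; ∈-filter⁺; ∈-allFin; ∈-deduplicate⁺; ∈-deduplicate⁻)
open import Data.List.Relation.Unary.Any using (here; there; index)
import Data.List.Relation.Unary.Any as Any
open import Data.List.Relation.Unary.Any.Properties using (lookup-index)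
import Data.List.Relation.Unary.All as All
open import Data.List.Relation.Unary.AllPairs using (_∷_)
open import Data.List.Relation.Unary.Unique.Propositional using (Unique)
open import Data.List.Relation.Unary.Unique.DecPropositional.Properties using (deduplicate-!)
open import Data.Fin using (Fin; toℕ; fromℕ<; fromℕ) renaming (zero to fzero; suc to fsuc)
open import Data.Fin.Properties using (any?; toℕ-fromℕ<; toℕ-fromℕ; toℕ-injective; toℕ<n; toℕ≤pred[n]; injective⇒≤)
open import Data.Product using (∃-syntax; _×_; _,_; proj₁; proj₂)
open import Data.Sum using (inj₁; inj₂)
open import Relation.Binary.PropositionalEquality
open import Relation.Binary.Definitions using (DecidableEquality)
open import Relation.Nullary using (¬_; Dec; yes; no; contradiction)
open import Relation.Nullary.Decidable using (_×-dec_)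

≤-maximum : ∀ {x xs} → x ∈ xs → x ≤ maximum xs
≤-maximum {x} {y ∷ ys} (here refl) = m≤m⊔n x (maximum ys)
≤-maximum {x} {y ∷ ys} (there p)   = ≤-trans (≤-maximum p) (m≤n⊔m y (maximum ys))

∈-concatMap-map⁺ : {A B C : Set} (f : A → B → C) {x : A} {y : B} {xs : List A} {ys : List B} →
                   x ∈ xs → y ∈ ys → f x y ∈ concatMap (λ x → map (f x) ys) xs
∈-concatMap-map⁺ f {ys = ys} x∈xs y∈ys =
  ∈-concatMap⁺ (λ x → map (f x) ys) (Any.map (λ { refl → ∈-map⁺ (f _) y∈ys }) x∈xs)

Unique⇒lookup-injective : {A : Set} {xs : List A} → Unique xs →
                          ∀ a b → lookup xs a ≡ lookup xs b → a ≡ b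
Unique⇒lookup-injective (_ ∷ _)     fzero    fzero    _ = refl
Unique⇒lookup-injective (x≢ ∷ _)    fzero    (fsuc b) e = contradiction e (All.lookup x≢ (∈-lookup b))
Unique⇒lookup-injective (x≢ ∷ _)    (fsuc a) fzero    e = contradiction (sym e) (All.lookup x≢ (∈-lookup a))
Unique⇒lookup-injective (_ ∷ uniq)  (fsuc a) (fsuc b) e = cong fsuc (Unique⇒lookup-injective uniq a b e)

injective-into-interval⇒≤ : ∀ {m lo hi} (f : Fin m → ℕ) →
                            (∀ a → lo ≤ f a × f a ≤ hi) →
                            (∀ {a b} → f a ≡ f b → a ≡ b) →
                            m ≤ suc hi ∸ lo
injective-into-interval⇒≤ {lo = lo} {hi} f bounds f-injective = injective⇒≤ {f = shifted} shifted-injective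
  where
  offset< : ∀ a → f a ∸ lo < suc hi ∸ lo
  offset< a = ∸-monoˡ-< (s≤s (proj₂ (bounds a))) (proj₁ (bounds a))
  shifted : Fin _ → Fin _
  shifted a = fromℕ< (offset< a)
  shifted-injective : ∀ {a b} → shifted a ≡ shifted b → a ≡ b
  shifted-injective {a} {b} eq = f-injective (begin
    f a            ≡⟨ sym (m∸n+n≡m (proj₁ (bounds a))) ⟩
    f a ∸ lo + lo  ≡⟨ cong (_+ lo) (begin
      f a ∸ lo          ≡⟨ sym (toℕ-fromℕ< (offset< a)) ⟩
      toℕ (shifted a)   ≡⟨ cong toℕ eq ⟩
      toℕ (shifted b)   ≡⟨ toℕ-fromℕ< (offset< b) ⟩
      f b ∸ lo          ∎) ⟩
    f b ∸ lo + lo  ≡⟨ m∸n+n≡m (proj₁ (bounds b)) ⟩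
    f b            ∎)
    where open ≡-Reasoning

module _ {A : Set} (P : List A) where
  private
    n : ℕ
    n = length P
    L : Fin n → A
    L = lookup P

  Covers : ℕ → ℕ → Set
  Covers lo hi = ∀ k → ∃[ k′ ] lo ≤ toℕ k′ × toℕ k′ ≤ hi × L k′ ≡ L k

  covers-whole : Covers 0 (pred n)
  covers-whole k = k , z≤n , toℕ≤pred[n] k , refl

  covers-dropFirst : ∀ {i m : Fin n} {hi} → Covers (toℕ i) hi →
                     toℕ i < toℕ m → toℕ m ≤ hi → L m ≡ L i → Covers (suc (toℕ i)) hi
  covers-dropFirst cov i<m m≤hi Lm≡Li k with cov k
  ... | k′ , i≤k′ , k′≤hi , Lk′≡Lk with m≤n⇒m<n∨m≡n i≤k′
  ...   | inj₁ i<k′ = k′ , i<k′ , k′≤hi , Lk′≡Lk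
  ...   | inj₂ i≡k′ = _ , i<m , m≤hi , trans Lm≡Li (trans (cong L (toℕ-injective i≡k′)) Lk′≡Lk)

  covers-dropLast : ∀ {j m : Fin n} {lo} → Covers lo (toℕ j) →
                    lo ≤ toℕ m → toℕ m < toℕ j → L m ≡ L j → Covers lo (pred (toℕ j))
  covers-dropLast cov lo≤m m<j Lm≡Lj k with cov k
  ... | k′ , lo≤k′ , k′≤j , Lk′≡Lk with m≤n⇒m<n∨m≡n k′≤j
  ...   | inj₁ k′<j = k′ , lo≤k′ , <⇒≤pred k′<j , Lk′≡Lk
  ...   | inj₂ k′≡j = _ , lo≤m , <⇒≤pred m<j , trans Lm≡Lj (trans (cong L (sym (toℕ-injective k′≡j))) Lk′≡Lk)

  position≤ : ∀ {m} (j : Fin n) → m ≤ toℕ j → Fin n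
  position≤ j m≤j = fromℕ< (≤-<-trans m≤j (toℕ<n j))

  FirstRecurs : Fin n → Fin n → Set
  FirstRecurs i j = ∃[ m ] toℕ i < toℕ m × toℕ m ≤ toℕ j × L m ≡ L i

  LastRecurs : Fin n → Fin n → Set
  LastRecurs i j = ∃[ m ] toℕ i ≤ toℕ m × toℕ m < toℕ j × L m ≡ L j

  sparseOcc-refl : (i : Fin n) → SparseOcc P (L i) (L i) i i
  sparseOcc-refl i = ≤-refl , refl , refl , λ k i<k k<i → contradiction (<-trans i<k k<i) (<-irrefl refl)

  sparseOcc-ends : ∀ {i j} → toℕ i ≤ toℕ j → ¬ FirstRecurs i j → ¬ LastRecurs i j →
                   SparseOcc P (L i) (L j) i j
  sparseOcc-ends i≤j ¬first ¬last = i≤j , refl , refl , λ k i<k k<j →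
    (λ Lk≡Li → ¬first (k , i<k , <⇒≤ k<j , Lk≡Li)) , (λ Lk≡Lj → ¬last (k , <⇒≤ i<k , k<j , Lk≡Lj))

  CoveringSparseOcc : Set
  CoveringSparseOcc = ∃[ i ] ∃[ j ] SparseOcc P (L i) (L j) i j × Covers (toℕ i) (toℕ j)

  module _ (_≟_ : DecidableEquality A) where

    firstRecurs? : ∀ i j → Dec (FirstRecurs i j)
    firstRecurs? i j = any? (λ m → (toℕ i <? toℕ m) ×-dec ((toℕ m ≤? toℕ j) ×-dec (L m ≟ L i)))

    lastRecurs? : ∀ i j → Dec (LastRecurs i j)
    lastRecurs? i j = any? (λ m → (toℕ i ≤? toℕ m) ×-dec ((toℕ m <? toℕ j) ×-dec (L m ≟ L j)))

    covers⇒numDistinct≤spanLen : ∀ {i j : Fin n} → Covers (toℕ i) (toℕ j) → numDistinct _≟_ P ≤ spanLen i j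
    covers⇒numDistinct≤spanLen {i} {j} cov =
      injective-into-interval⇒≤ (λ a → toℕ (witness a)) (λ a → let _ , i≤ , ≤j , _ = cover a in i≤ , ≤j)
        λ {a} {b} eq → Unique⇒lookup-injective (deduplicate-! _≟_ P) a b (begin
          lookup D a           ≡⟨ char≡ a ⟩
          L (witness a)        ≡⟨ cong L (toℕ-injective eq) ⟩
          L (witness b)        ≡⟨ sym (char≡ b) ⟩
          lookup D b           ∎)
      where
      open ≡-Reasoning
      D = deduplicate _≟_ P
      occurrence : ∀ a → lookup D a ∈ P
      occurrence a = ∈-deduplicate⁻ _≟_ P (∈-lookup a)
      cover : ∀ a → ∃[ k′ ] toℕ i ≤ toℕ k′ × toℕ k′ ≤ toℕ j × L k′ ≡ L (index (occurrence a))
      cover a = cov (index (occurrence a))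
      witness : Fin (length D) → Fin n
      witness a = proj₁ (cover a)
      char≡ : ∀ a → lookup D a ≡ L (witness a)
      char≡ a = trans (lookup-index (occurrence a)) (sym (proj₂ (proj₂ (proj₂ (cover a)))))

    spanLen≤sparseUVLength : ∀ {u v i j} → SparseOcc P u v i j → spanLen i j ≤ sparseUVLength _≟_ P u v
    spanLen≤sparseUVLength {u} {v} {i} {j} occ = ≤-maximum (∈-map⁺ (λ ij → spanLen (proj₁ ij) (proj₂ ij))
      (∈-filter⁺ (λ ij → sparseOcc? _≟_ P u v (proj₁ ij) (proj₂ ij))
        (∈-concatMap-map⁺ _,_ (∈-allFin i) (∈-allFin j)) occ))

    sparseUVLength≤sparseLength : ∀ {u v} → u ∈ P → v ∈ P → sparseUVLength _≟_ P u v ≤ sparseLength _≟_ P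
    sparseUVLength≤sparseLength u∈P v∈P = ≤-maximum
      (∈-concatMap-map⁺ (sparseUVLength _≟_ P) (∈-deduplicate⁺ _≟_ u∈P) (∈-deduplicate⁺ _≟_ v∈P))

    covers⇒coveringSparseOcc : ∀ d (i j : Fin n) → toℕ i + d ≡ toℕ j → Covers (toℕ i) (toℕ j) → CoveringSparseOcc
    covers⇒coveringSparseOcc zero i j i+0≡j cov with toℕ-injective {i = i} {j} (trans (sym (+-identityʳ _)) i+0≡j)
    ... | refl = i , i , sparseOcc-refl i , cov
    covers⇒coveringSparseOcc (suc d) i j i+1+d≡j cov with firstRecurs? i j
    ... | yes (m , i<m , m≤j , Lm≡Li) =
      covers⇒coveringSparseOcc d next j
        (trans (cong (_+ d) toℕ-next) (trans (sym (+-suc (toℕ i) d)) i+1+d≡j))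
        (subst (λ lo → Covers lo (toℕ j)) (sym toℕ-next) (covers-dropFirst cov i<m m≤j Lm≡Li))
      where
      next = position≤ j (<-≤-trans i<m m≤j)
      toℕ-next : toℕ next ≡ suc (toℕ i)
      toℕ-next = toℕ-fromℕ< _
    ... | no ¬first with lastRecurs? i j
    ...   | yes (m , i≤m , m<j , Lm≡Lj) =
      covers⇒coveringSparseOcc d i previous
        (trans (cong pred (trans (sym (+-suc (toℕ i) d)) i+1+d≡j)) (sym toℕ-previous))
        (subst (Covers (toℕ i)) (sym toℕ-previous) (covers-dropLast cov i≤m m<j Lm≡Lj))
      where
      previous = position≤ j pred[n]≤n
      toℕ-previous : toℕ previous ≡ pred (toℕ j)
      toℕ-previous = toℕ-fromℕ< _
    ...   | no ¬last = i , j , sparseOcc-ends (subst (toℕ i ≤_) i+1+d≡j (m≤m+n _ _)) ¬first ¬last , cov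

coveringSparseOcc : {A : Set} → DecidableEquality A → (x : A) (xs : List A) → CoveringSparseOcc (x ∷ xs)
coveringSparseOcc _≟_ x xs =
  covers⇒coveringSparseOcc (x ∷ xs) _≟_ (length xs) fzero (fromℕ (length xs))
    (sym toℕ-last) (subst (Covers (x ∷ xs) 0) (sym toℕ-last) (covers-whole (x ∷ xs)))
  where
  toℕ-last : toℕ (fromℕ (length xs)) ≡ length xs
  toℕ-last = toℕ-fromℕ (length xs)

lemma3 : {A : Set} (_≟_ : DecidableEquality A) (P : List A) →
         numDistinct _≟_ P ≤ sparseLength _≟_ P
lemma3 _≟_ [] = z≤n
lemma3 _≟_ P@(x ∷ xs) with i , j , occ , cov ← coveringSparseOcc _≟_ x xs = begin
  numDistinct _≟_ P                               ≤⟨ covers⇒numDistinct≤spanLen P _≟_ cov ⟩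
  spanLen i j                                     ≤⟨ spanLen≤sparseUVLength P _≟_ occ ⟩
  sparseUVLength _≟_ P (lookup P i) (lookup P j)  ≤⟨ sparseUVLength≤sparseLength P _≟_ (∈-lookup i) (∈-lookup j) ⟩
  sparseLength _≟_ P                              ∎
  where open ≤-Reasoning
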